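{- Let $p\geq 2$ and let $G$ be a $2p$-regular graph. Then $G$ is $(p+2)$-star colourable if and only if $G$ admits a $(p+2)$-colourful Eulerian orientation.
   Context: A $k$-star colouring is a proper vertex colouring with $k$ colours in which no path on 4 vertices receives only two colours. An orientation of $G$ is obtained by directing each edge. An Eulerian orientation is one in which every vertex has in-degree equal to out-degree. An Eulerian orientation $\vec G$ of $G$ is a $q$-colourful Eulerian orientation if there exists a proper $q$-colouring $f$ of $G$ such that for every vertex $v$: (i) all in-neighbours of $v$ have the same colour $c_v$; (ii) no out-neighbour of $v$ has colour $c_v$; (iii) the out-neighbours of $v$ have pairwise distinct colours. -}

module Defs where

open import Data.Nat using (ℕ; _+_; _*_)
open import Data.Fin using (Fin)
open import Data.List using (List; length; filter; allFin)
open import Data.Product using (Σ; ∃; _×_; _,_)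
open import Data.Sum using (_⊎_)
open import Relation.Nullary using (¬_; Dec)
open import Relation.Binary.PropositionalEquality using (_≡_; _≢_)

record Graph : Set₁ where
  field
    n     : ℕ
    Adj   : Fin n → Fin n → Set
    adj?  : (u v : Fin n) → Dec (Adj u v)
    sym   : ∀ {u v} → Adj u v → Adj v u
    irrefl : ∀ {u} → ¬ Adj u u

open Graph public

degree : (G : Graph) → Fin (n G) → ℕ
degree G v = length (filter (adj? G v) (allFin (n G)))

Regular : ℕ → Graph → Set
Regular d G = ∀ v → degree G v ≡ d

Colouring : Graph → ℕ → Set
Colouring G k = Fin (n G) → Fin k

Proper : (G : Graph) {k : ℕ} → Colouring G k → Set
Proper G f = ∀ u v → Adj G u v → f u ≢ f v

Path4 : (G : Graph) → (a b c d : Fin (n G)) → Set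
Path4 G a b c d =
  Adj G a b × Adj G b c × Adj G c d ×
  a ≢ b × a ≢ c × a ≢ d × b ≢ c × b ≢ d × c ≢ d

TwoColoured4 : {m k : ℕ} → (Fin m → Fin k) → (a b c d : Fin m) → Set
TwoColoured4 {k = k} f a b c d =
  Σ (Fin k) λ x → Σ (Fin k) λ y →
    (f a ≡ x ⊎ f a ≡ y) × (f b ≡ x ⊎ f b ≡ y) ×
    (f c ≡ x ⊎ f c ≡ y) × (f d ≡ x ⊎ f d ≡ y)

IsStarColouring : (G : Graph) (k : ℕ) → Colouring G k → Set
IsStarColouring G k f =
  Proper G f ×
  (∀ a b c d → Path4 G a b c d → ¬ TwoColoured4 f a b c d)

StarColourable : ℕ → Graph → Set
StarColourable k G = Σ (Colouring G k) (IsStarColouring G k)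

record Orientation (G : Graph) : Set₁ where
  field
    Arc     : Fin (n G) → Fin (n G) → Set
    arc?    : (u v : Fin (n G)) → Dec (Arc u v)
    arc-adj : ∀ {u v} → Arc u v → Adj G u v
    total   : ∀ {u v} → Adj G u v → Arc u v ⊎ Arc v u
    antisym : ∀ {u v} → Arc u v → ¬ Arc v u

open Orientation public

outdeg : (G : Graph) → Orientation G → Fin (n G) → ℕ
outdeg G O v = length (filter (arc? O v) (allFin (n G)))

indeg : (G : Graph) → Orientation G → Fin (n G) → ℕ
indeg G O v = length (filter (λ u → arc? O u v) (allFin (n G)))

Eulerian : (G : Graph) → Orientation G → Set
Eulerian G O = ∀ v → indeg G O v ≡ outdeg G O v

ColourfulFor : (G : Graph) (q : ℕ) → Orientation G → Colouring G q → Set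
ColourfulFor G q O f =
  ∀ v → Σ (Fin q) λ cv →
    (∀ u → Arc O u v → f u ≡ cv) ×
    (∀ w → Arc O v w → f w ≢ cv) ×
    (∀ w w′ → Arc O v w → Arc O v w′ → f w ≡ f w′ → w ≡ w′)

HasColourfulEulerianOrientation : ℕ → Graph → Set₁
HasColourfulEulerianOrientation q G =
  Σ (Orientation G) λ O → Eulerian G O ×
    Σ (Colouring G q) λ f → Proper G f × ColourfulFor G q O f

-- Given a star colouring f, orient uv towards v when some other neighbour of v has colour f u.
-- A star colouring makes this asymmetric. Properness makes the colours of v and of its
-- neighbours that are not in-neighbours pairwise distinct and different from every
-- in-neighbour's colour; with p + 2 colours and degree 2p this forces in-degree ≥ p everywhere,
-- hence out-degree ≤ p, and since both degree sums count the arcs, all in- and out-degrees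
-- equal p. So every edge is oriented, and the palette at v leaves room for only one
-- in-neighbour colour. Conversely, in a colourful orientation both ends of a path l m r with
-- f l = f r point into m, so a two-coloured path a b c d would need both c → b and b → c.

module Submission where

open import Defs hiding (sym)
open import Data.Nat using (ℕ; suc; _+_; _*_; _≤_; _<_; z≤n; s≤s)
open import Data.Nat.Properties hiding (_≟_)
open import Data.Nat.ListAction using (sum)
open import Algebra.Properties.CommutativeSemigroup +-commutativeSemigroup using (x∙yz≈y∙xz)
open import Data.Product using (_×_; _,_; proj₁; ∃-syntax)
open import Data.Sum using (_⊎_; inj₁; inj₂; [_,_])
open import Data.Fin using (Fin; zero; suc; _≟_)
open import Data.Fin.Properties using (any?; injective⇒≤)
open import Data.List using (List; []; _∷_; length; filter; allFin; map; lookup)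
open import Data.List.Properties using (length-map; filter-≐; filter-none)
open import Data.List.Membership.Propositional using (_∈_)
open import Data.List.Membership.Propositional.Properties using (∈-lookup; ∈-allFin)
open import Data.List.Relation.Unary.All as All using (All; []; _∷_)
open import Data.List.Relation.Unary.All.Properties as All using (all-filter)
open import Data.List.Relation.Unary.AllPairs using ([]; _∷_)
open import Data.List.Relation.Unary.Any using (here; there)
open import Data.List.Relation.Unary.Unique.Propositional using (Unique)
open import Data.List.Relation.Unary.Unique.Propositional.Properties using (allFin⁺; filter⁺)
open import Function.Base using (_∘_)
open import Function.Definitions using (Injective)
open import Relation.Nullary using (¬_; Dec; yes; no; ¬?; contradiction)
open import Relation.Nullary.Decidable using (_×-dec_)
open import Relation.Unary using (Decidable; _⊆_; _≐_; _∪_) renaming (_⊥_ to Disjoint)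
open import Relation.Unary.Properties using (_∪?_)
open import Relation.Binary.PropositionalEquality
  using (_≡_; _≢_; refl; sym; trans; cong; cong₂; subst)

module _ {A : Set} where

  count : {P : A → Set} → Decidable P → List A → ℕ
  count P? xs = length (filter P? xs)

  module _ {P Q : A → Set} (P? : Decidable P) (Q? : Decidable Q) where

    count-≐ : P ≐ Q → ∀ xs → count P? xs ≡ count Q? xs
    count-≐ P≐Q xs = cong length (filter-≐ P? Q? P≐Q xs)

    count-∪ : Disjoint P Q → ∀ xs → count (P? ∪? Q?) xs ≡ count P? xs + count Q? xs
    count-∪ P⊥Q [] = refl
    count-∪ P⊥Q (x ∷ xs) with P? x | Q? x
    ... | yes px | yes qx = contradiction (px , qx) P⊥Q
    ... | yes _  | no _   = cong suc (count-∪ P⊥Q xs)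
    ... | no _   | yes _  = trans (cong suc (count-∪ P⊥Q xs)) (sym (+-suc _ _))
    ... | no _   | no _   = count-∪ P⊥Q xs

    count-mono : P ⊆ Q → ∀ xs → count P? xs ≤ count Q? xs
    count-mono P⊆Q [] = z≤n
    count-mono P⊆Q (x ∷ xs) with P? x | Q? x
    ... | yes px | no ¬qx = contradiction (P⊆Q px) ¬qx
    ... | yes _  | yes _  = s≤s (count-mono P⊆Q xs)
    ... | no _   | yes _  = m≤n⇒m≤1+n (count-mono P⊆Q xs)
    ... | no _   | no _   = count-mono P⊆Q xs

    count-mono-< : P ⊆ Q → ∀ {y xs} → y ∈ xs → Q y → ¬ P y → count P? xs < count Q? xs
    count-mono-< P⊆Q {xs = x ∷ xs} (here refl) qx ¬px with P? x | Q? x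
    ... | yes px | _      = contradiction px ¬px
    ... | no _   | no ¬qx = contradiction qx ¬qx
    ... | no _   | yes _  = s≤s (count-mono P⊆Q xs)
    count-mono-< P⊆Q {xs = x ∷ xs} (there y∈xs) qy ¬py with P? x | Q? x
    ... | yes px | no ¬qx = contradiction (P⊆Q px) ¬qx
    ... | yes _  | yes _  = s≤s (count-mono-< P⊆Q y∈xs qy ¬py)
    ... | no _   | yes _  = m≤n⇒m≤1+n (count-mono-< P⊆Q y∈xs qy ¬py)
    ... | no _   | no _   = count-mono-< P⊆Q y∈xs qy ¬py

  sum-map-mono : {g h : A → ℕ} → (∀ x → g x ≤ h x) → ∀ xs → sum (map g xs) ≤ sum (map h xs)
  sum-map-mono g≤h [] = z≤n
  sum-map-mono g≤h (x ∷ xs) = +-mono-≤ (g≤h x) (sum-map-mono g≤h xs)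

  sum-map-tight : {g h : A → ℕ} → (∀ x → g x ≤ h x) → ∀ xs →
    sum (map g xs) ≡ sum (map h xs) → ∀ {y} → y ∈ xs → g y ≡ h y
  sum-map-tight {g} {h} g≤h (x ∷ xs) eq (here refl) = ≤-antisym (g≤h x)
    (+-cancelʳ-≤ (sum (map g xs)) (h x) (g x)
      (subst (h x + sum (map g xs) ≤_) (sym eq) (+-monoʳ-≤ (h x) (sum-map-mono g≤h xs))))
  sum-map-tight {g} {h} g≤h (x ∷ xs) eq (there y∈xs) = sum-map-tight g≤h xs
    (+-cancelˡ-≡ (g x) _ _ (trans eq (cong (_+ sum (map h xs)) (sym (sum-map-tight g≤h (x ∷ xs) eq (here refl))))))
    y∈xs

  module _ {R : A → A → Set} (R? : ∀ x y → Dec (R x y)) where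

    private
      column : List A → A → ℕ
      column xs y = count (λ x → R? x y) xs

    sum-count-zero : ∀ ys → sum (map (column []) ys) ≡ 0
    sum-count-zero [] = refl
    sum-count-zero (y ∷ ys) = sum-count-zero ys

    private
      +-insert : ∀ a c {b d} → b ≡ c + d → a + b ≡ c + (a + d)
      +-insert a c {d = d} b≡c+d = trans (cong (a +_) b≡c+d) (x∙yz≈y∙xz a c d)

    sum-count-∷ : ∀ x xs ys →
      sum (map (column (x ∷ xs)) ys) ≡ count (R? x) ys + sum (map (column xs) ys)
    sum-count-∷ x xs [] = refl
    sum-count-∷ x xs (y ∷ ys) with R? x y
    ... | yes _ = cong suc (+-insert (column xs y) (count (R? x) ys) (sum-count-∷ x xs ys))
    ... | no _  = +-insert (column xs y) (count (R? x) ys) (sum-count-∷ x xs ys)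

    double-counting : ∀ xs ys →
      sum (map (λ y → count (λ x → R? x y) xs) ys) ≡ sum (map (λ x → count (R? x) ys) xs)
    double-counting [] ys = sum-count-zero ys
    double-counting (x ∷ xs) ys =
      trans (sum-count-∷ x xs ys) (cong (count (R? x) ys +_) (double-counting xs ys))

lookup-injective : {A : Set} {xs : List A} → Unique xs → Injective _≡_ _≡_ (lookup xs)
lookup-injective (_   ∷ _) {zero}  {zero}  _  = refl
lookup-injective (x∉ ∷ _) {zero}  {suc j} eq = contradiction eq (All.lookup x∉ (∈-lookup j))
lookup-injective (x∉ ∷ _) {suc i} {zero}  eq = contradiction (sym eq) (All.lookup x∉ (∈-lookup i))
lookup-injective (_   ∷ u) {suc i} {suc j} eq = cong suc (lookup-injective u eq)

Unique-map-on : {A B : Set} {P : A → Set} {g : A → B} →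
  (∀ {a b} → P a → P b → g a ≡ g b → a ≡ b) → ∀ {xs} → All P xs → Unique xs → Unique (map g xs)
Unique-map-on inj [] [] = []
Unique-map-on inj (pa ∷ ps) (a∉ ∷ u) =
  All.map⁺ (All.zipWith (λ (pb , a≢b) → a≢b ∘ inj pa pb) (ps , a∉)) ∷ Unique-map-on inj ps u

Unique⇒length≤ : {k : ℕ} {xs : List (Fin k)} → Unique xs → length xs ≤ k
Unique⇒length≤ u = injective⇒≤ (lookup-injective u)

alternating-≡ : {A : Set} {x y a b c : A} → a ≡ x ⊎ a ≡ y → b ≡ x ⊎ b ≡ y → c ≡ x ⊎ c ≡ y →
  a ≢ b → c ≢ b → a ≡ c
alternating-≡ (inj₁ a≡x) (inj₁ b≡x) _ a≢b _ = contradiction (trans a≡x (sym b≡x)) a≢b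
alternating-≡ (inj₂ a≡y) (inj₂ b≡y) _ a≢b _ = contradiction (trans a≡y (sym b≡y)) a≢b
alternating-≡ (inj₁ a≡x) (inj₂ _) (inj₁ c≡x) _ _ = trans a≡x (sym c≡x)
alternating-≡ (inj₂ a≡y) (inj₁ _) (inj₂ c≡y) _ _ = trans a≡y (sym c≡y)
alternating-≡ (inj₁ _) (inj₂ b≡y) (inj₂ c≡y) _ c≢b = contradiction (trans c≡y (sym b≡y)) c≢b
alternating-≡ (inj₂ _) (inj₁ b≡x) (inj₁ c≡x) _ c≢b = contradiction (trans c≡x (sym b≡x)) c≢b

adj⇒≢ : (G : Graph) {u v : Fin (n G)} → Adj G u v → u ≢ v
adj⇒≢ G a refl = irrefl G a

StarFree : (G : Graph) {k : ℕ} → Colouring G k → Set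
StarFree G f = ∀ a b c d → Path4 G a b c d → ¬ TwoColoured4 f a b c d

module Repetition (G : Graph) {k : ℕ} (f : Colouring G k) (proper : Proper G f) where

  V : Set
  V = Fin (n G)

  vertices : List V
  vertices = allFin (n G)

  infix 4 _↝_ _↝?_
  _↝_ : V → V → Set
  u ↝ v = Adj G u v × ∃[ u′ ] (Adj G u′ v × u′ ≢ u × f u′ ≡ f u)

  _↝?_ : ∀ u v → Dec (u ↝ v)
  u ↝? v = adj? G u v ×-dec any? (λ u′ → adj? G u′ v ×-dec ¬? (u′ ≟ u) ×-dec (f u′ ≟ f u))

  indegree outdegree : V → ℕ
  indegree v = count (_↝? v) vertices
  outdegree v = count (v ↝?_) vertices

  NonIn : V → V → Set
  NonIn v u = Adj G v u × ¬ u ↝ v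

  NonIn? : ∀ v u → Dec (NonIn v u)
  NonIn? v u = adj? G v u ×-dec ¬? (u ↝? v)

  nonIndegree : V → ℕ
  nonIndegree v = count (NonIn? v) vertices

  degree≡indegree+nonIndegree : ∀ v → degree G v ≡ indegree v + nonIndegree v
  degree≡indegree+nonIndegree v = trans
    (count-≐ (adj? G v) ((_↝? v) ∪? NonIn? v) (split , join) vertices)
    (count-∪ (_↝? v) (NonIn? v) (λ (u↝v , _ , ¬u↝v) → ¬u↝v u↝v) vertices)
    where
    split : Adj G v ⊆ (_↝ v) ∪ NonIn v
    split {u} a with u ↝? v
    ... | yes u↝v = inj₁ u↝v
    ... | no ¬u↝v = inj₂ (a , ¬u↝v)
    join : (_↝ v) ∪ NonIn v ⊆ Adj G v
    join (inj₁ (a , _)) = Graph.sym G a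
    join (inj₂ (a , _)) = a

  nonIn-colour-injective : ∀ {v a b} → NonIn v a → NonIn v b → f a ≡ f b → a ≡ b
  nonIn-colour-injective {v} {a} {b} (va , ¬a↝v) (vb , _) fa≡fb with b ≟ a
  ... | yes b≡a = sym b≡a
  ... | no b≢a = contradiction (Graph.sym G va , b , Graph.sym G vb , b≢a , sym fa≡fb) ¬a↝v

  in-colour∉nonIn : ∀ {u v w} → u ↝ v → NonIn v w → f u ≢ f w
  in-colour∉nonIn {u} {v} {w} u↝v (vw , ¬w↝v) fu≡fw =
    ¬w↝v (Graph.sym G vw , u , proj₁ u↝v , u≢w , fu≡fw)
    where
    u≢w : u ≢ w
    u≢w refl = ¬w↝v u↝v

  palette : V → List (Fin k)
  palette v = f v ∷ map f (filter (NonIn? v) vertices)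

  length-palette : ∀ v → length (palette v) ≡ suc (nonIndegree v)
  length-palette v = cong suc (length-map f (filter (NonIn? v) vertices))

  unique-palette : ∀ v → Unique (palette v)
  unique-palette v =
    All.map⁺ (All.map (λ (vw , _) → proper v _ vw) nonIn) ∷
    Unique-map-on nonIn-colour-injective nonIn (filter⁺ (NonIn? v) (allFin⁺ (n G)))
    where
    nonIn : All (NonIn v) (filter (NonIn? v) vertices)
    nonIn = all-filter (NonIn? v) vertices

  in-colour∉palette : ∀ {u v} → u ↝ v → All (f u ≢_) (palette v)
  in-colour∉palette {u} {v} u↝v =
    (λ fu≡fv → proper v u (Graph.sym G (proj₁ u↝v)) (sym fu≡fv)) ∷
    All.map⁺ (All.map (in-colour∉nonIn u↝v) (all-filter (NonIn? v) vertices))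

  palette-bound : ∀ v → suc (nonIndegree v) ≤ k
  palette-bound v = subst (_≤ k) (length-palette v) (Unique⇒length≤ (unique-palette v))

  palette-bound-in : ∀ {u v} → u ↝ v → 2 + nonIndegree v ≤ k
  palette-bound-in {u} {v} u↝v = subst (_≤ k) (cong suc (length-palette v))
    (Unique⇒length≤ (in-colour∉palette u↝v ∷ unique-palette v))

  palette-bound-two-in : ∀ {u₁ u₂ v} → u₁ ↝ v → u₂ ↝ v → f u₁ ≢ f u₂ → 3 + nonIndegree v ≤ k
  palette-bound-two-in {v = v} u₁↝v u₂↝v fu₁≢fu₂ = subst (_≤ k) (cong (2 +_) (length-palette v))
    (Unique⇒length≤ ((fu₁≢fu₂ ∷ in-colour∉palette u₁↝v) ∷ in-colour∉palette u₂↝v ∷ unique-palette v))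

  -- u ↝ v ↝ u would make the path u′ v u v′ two-coloured.
  ↝-asym : StarFree G f → ∀ {u v} → u ↝ v → ¬ v ↝ u
  ↝-asym starFree {u} {v} (uv , u′ , u′v , u′≢u , fu′≡fu) (vu , v′ , v′u , v′≢v , fv′≡fv) =
    starFree u′ v u v′
      (u′v , vu , Graph.sym G v′u ,
       adj⇒≢ G u′v , u′≢u , u′≢v′ , adj⇒≢ G vu , v≢v′ , adj⇒≢ G (Graph.sym G v′u))
      (f u , f v , inj₁ fu′≡fu , inj₂ refl , inj₁ refl , inj₂ fv′≡fv)
    where
    u′≢v′ : u′ ≢ v′
    u′≢v′ refl = proper u v uv (trans (sym fu′≡fu) fv′≡fv)
    v≢v′ : v ≢ v′
    v≢v′ v≡v′ = v′≢v (sym v≡v′)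

module StarOrientation (p : ℕ) (2≤p : 2 ≤ p) (G : Graph) (regular : Regular (2 * p) G)
  (f : Colouring G (p + 2)) (proper : Proper G f) (starFree : StarFree G f) where

  open Repetition G f proper
  open ≤-Reasoning

  asym : ∀ {u v} → u ↝ v → ¬ v ↝ u
  asym = ↝-asym starFree

  degree≡p+p : ∀ v → degree G v ≡ p + p
  degree≡p+p v = trans (regular v) (cong (p +_) (+-identityʳ p))

  indegree+nonIndegree≡p+p : ∀ v → indegree v + nonIndegree v ≡ p + p
  indegree+nonIndegree≡p+p v = trans (sym (degree≡indegree+nonIndegree v)) (degree≡p+p v)

  p≤indegree : ∀ v → p ≤ indegree v
  p≤indegree v with any? (_↝? v)
  ... | yes (u , u↝v) = +-cancelʳ-≤ p p (indegree v) (begin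
    p + p                         ≡⟨ indegree+nonIndegree≡p+p v ⟨
    indegree v + nonIndegree v    ≤⟨ +-monoʳ-≤ (indegree v) nonIndegree≤p ⟩
    indegree v + p                ∎)
    where
    nonIndegree≤p : nonIndegree v ≤ p
    nonIndegree≤p = +-cancelʳ-≤ 2 (nonIndegree v) p
      (subst (_≤ p + 2) (+-comm 2 (nonIndegree v)) (palette-bound-in u↝v))
  ... | no ¬in = contradiction (begin-strict
    p + p              ≡⟨ indegree+nonIndegree≡p+p v ⟨
    indegree v + nonIndegree v ≡⟨ cong (_+ nonIndegree v) indegree≡0 ⟩
    nonIndegree v      <⟨ palette-bound v ⟩
    p + 2              ≤⟨ +-monoʳ-≤ p 2≤p ⟩
    p + p              ∎) (<-irrefl refl)
    where
    indegree≡0 : indegree v ≡ 0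
    indegree≡0 = cong length (filter-none (_↝? v) {vertices} (All.tabulate (λ {u} _ u↝v → ¬in (u , u↝v))))

  InOrOut? : ∀ v → Decidable ((_↝ v) ∪ (v ↝_))
  InOrOut? v = (_↝? v) ∪? (v ↝?_)

  count-in-or-out : ∀ v → count (InOrOut? v) vertices ≡ indegree v + outdegree v
  count-in-or-out v = count-∪ (_↝? v) (v ↝?_) (λ (u↝v , v↝u) → asym u↝v v↝u) vertices

  in-or-out⇒adj : ∀ {v} → (_↝ v) ∪ (v ↝_) ⊆ Adj G v
  in-or-out⇒adj (inj₁ (uv , _)) = Graph.sym G uv
  in-or-out⇒adj (inj₂ (vu , _)) = vu

  indegree+outdegree≤p+p : ∀ v → indegree v + outdegree v ≤ p + p
  indegree+outdegree≤p+p v = begin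
    indegree v + outdegree v        ≡⟨ count-in-or-out v ⟨
    count (InOrOut? v) vertices     ≤⟨ count-mono (InOrOut? v) (adj? G v) in-or-out⇒adj vertices ⟩
    degree G v                      ≡⟨ degree≡p+p v ⟩
    p + p                           ∎

  outdegree≤p : ∀ v → outdegree v ≤ p
  outdegree≤p v = +-cancelˡ-≤ p (outdegree v) p (begin
    p + outdegree v            ≤⟨ +-monoˡ-≤ (outdegree v) (p≤indegree v) ⟩
    indegree v + outdegree v   ≤⟨ indegree+outdegree≤p+p v ⟩
    p + p                      ∎)

  -- out ≤ p ≤ in at every vertex, while the two degree sums agree.
  outdegree≡indegree : ∀ v → outdegree v ≡ indegree v
  outdegree≡indegree v = sum-map-tight (λ w → ≤-trans (outdegree≤p w) (p≤indegree w)) vertices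
    (sym (double-counting _↝?_ vertices vertices)) (∈-allFin v)

  indegree≡p : ∀ v → indegree v ≡ p
  indegree≡p v = ≤-antisym (+-cancelˡ-≤ p (indegree v) p (begin
    p + indegree v            ≤⟨ +-monoˡ-≤ (indegree v) (p≤indegree v) ⟩
    indegree v + indegree v   ≡⟨ cong (indegree v +_) (outdegree≡indegree v) ⟨
    indegree v + outdegree v  ≤⟨ indegree+outdegree≤p+p v ⟩
    p + p                     ∎)) (p≤indegree v)

  ↝-total : ∀ {u w} → Adj G u w → u ↝ w ⊎ w ↝ u
  ↝-total {u} {w} uw with u ↝? w | w ↝? u
  ... | yes u↝w | _       = inj₁ u↝w
  ... | no _    | yes w↝u = inj₂ w↝u
  ... | no ¬u↝w | no ¬w↝u = contradiction (begin-strict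
    p + p                        ≡⟨ cong₂ _+_ (indegree≡p u) (trans (outdegree≡indegree u) (indegree≡p u)) ⟨
    indegree u + outdegree u     ≡⟨ count-in-or-out u ⟨
    count (InOrOut? u) vertices  <⟨ count-mono-< (InOrOut? u) (adj? G u) in-or-out⇒adj (∈-allFin w) uw
                                      [ ¬w↝u , ¬u↝w ] ⟩
    degree G u                   ≡⟨ degree≡p+p u ⟩
    p + p                        ∎) (<-irrefl refl)

  orientation : Orientation G
  orientation = record
    { Arc = _↝_ ; arc? = _↝?_ ; arc-adj = proj₁ ; total = ↝-total ; antisym = asym }

  eulerian : Eulerian G orientation
  eulerian v = sym (outdegree≡indegree v)

  in-colours-equal : ∀ {u₁ u₂ v} → u₁ ↝ v → u₂ ↝ v → f u₁ ≡ f u₂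
  in-colours-equal {u₁} {u₂} {v} u₁↝v u₂↝v with f u₁ ≟ f u₂
  ... | yes fu₁≡fu₂ = fu₁≡fu₂
  ... | no fu₁≢fu₂ = contradiction (begin-strict
    2 + p               ≡⟨ cong (2 +_) nonIndegree≡p ⟨
    2 + nonIndegree v   <⟨ palette-bound-two-in u₁↝v u₂↝v fu₁≢fu₂ ⟩
    p + 2               ≡⟨ +-comm p 2 ⟩
    2 + p               ∎) (<-irrefl refl)
    where
    nonIndegree≡p : nonIndegree v ≡ p
    nonIndegree≡p = +-cancelˡ-≡ p _ _
      (trans (cong (_+ nonIndegree v) (sym (indegree≡p v))) (indegree+nonIndegree≡p+p v))

  out-colour≢in-colour : ∀ {u v w} → u ↝ v → v ↝ w → f w ≢ f u
  out-colour≢in-colour {u} {v} {w} u↝v v↝w fw≡fu =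
    asym (Graph.sym G (proj₁ v↝w) , u , proj₁ u↝v , u≢w , sym fw≡fu) v↝w
    where
    u≢w : u ≢ w
    u≢w refl = asym u↝v v↝w

  out-colours-injective : ∀ {v} w w′ → v ↝ w → v ↝ w′ → f w ≡ f w′ → w ≡ w′
  out-colours-injective w w′ v↝w v↝w′ fw≡fw′ with w′ ≟ w
  ... | yes w′≡w = sym w′≡w
  ... | no w′≢w = contradiction v↝w
        (asym (Graph.sym G (proj₁ v↝w) , w′ , Graph.sym G (proj₁ v↝w′) , w′≢w , sym fw≡fw′))

  -- c_v is the common colour of the in-neighbours of v, or f v if there are none.
  colourful : ColourfulFor G (p + 2) orientation f
  colourful v with any? (_↝? v)
  ... | yes (u , u↝v) = f u , (λ u′ u′↝v → in-colours-equal u′↝v u↝v) ,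
                        (λ w → out-colour≢in-colour u↝v) , out-colours-injective
  ... | no ¬in = f v , (λ u u↝v → contradiction (u , u↝v) ¬in) ,
                 (λ w v↝w fw≡fv → proper v w (proj₁ v↝w) (sym fw≡fv)) , out-colours-injective

module ColourfulOrientation (G : Graph) {q : ℕ} (O : Orientation G) (f : Colouring G q)
  (proper : Proper G f) (colourful : ColourfulFor G q O f) where

  arc-into-middle : ∀ {l m r} → Adj G l m → Adj G m r → f l ≡ f r → l ≢ r → Arc O r m
  arc-into-middle {l} {m} {r} lm mr fl≡fr l≢r with colourful m | total O lm | total O mr
  ... | _ | _ | inj₂ r→m = r→m
  ... | _ , in-col , out-col , _ | inj₁ l→m | inj₁ m→r =
    contradiction (trans (sym fl≡fr) (in-col l l→m)) (out-col r m→r)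
  ... | _ , _ , _ , out-inj | inj₂ m→l | inj₁ m→r =
    contradiction (out-inj l r m→l m→r fl≡fr) l≢r

  starFree : StarFree G f
  starFree a b c d (ab , bc , cd , _ , a≢c , _ , _ , b≢d , _) (_ , _ , a∈ , b∈ , c∈ , d∈) =
    antisym O (arc-into-middle ab bc fa≡fc a≢c)
              (arc-into-middle (Graph.sym G cd) (Graph.sym G bc) fd≡fb (b≢d ∘ sym))
    where
    fa≡fc : f a ≡ f c
    fa≡fc = alternating-≡ a∈ b∈ c∈ (proper a b ab) (proper c b (Graph.sym G bc))
    fd≡fb : f d ≡ f b
    fd≡fb = alternating-≡ d∈ c∈ b∈ (proper d c (Graph.sym G cd)) (proper b c bc)

theorem8 : (p : ℕ) → 2 ≤ p → (G : Graph) → Regular (2 * p) G →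
    ((StarColourable (p + 2) G → HasColourfulEulerianOrientation (p + 2) G) ×
     (HasColourfulEulerianOrientation (p + 2) G → StarColourable (p + 2) G))
theorem8 p 2≤p G regular = star⇒orientation , orientation⇒star
  where
  star⇒orientation : StarColourable (p + 2) G → HasColourfulEulerianOrientation (p + 2) G
  star⇒orientation (f , proper , starFree) =
    orientation , eulerian , f , proper , colourful
    where open StarOrientation p 2≤p G regular f proper starFree

  orientation⇒star : HasColourfulEulerianOrientation (p + 2) G → StarColourable (p + 2) G
  orientation⇒star (O , _ , f , proper , colourful) =
    f , proper , ColourfulOrientation.starFree G O f proper colourful
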